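{- Let $k$ be a nonnegative integer with prime factorization $k=p_1^{\alpha_1}\cdots p_\ell^{\alpha_\ell}$, and suppose that for each $i\in\{1,\dots,\ell\}$ there is a pair $(n_i,m_i)$ with $p_i\in R(n_i,m_i)$. Then \[k\in R\Big(\sum_{i=1}^{\ell}\alpha_i n_i,\ \sum_{i=1}^{\ell}\alpha_i m_i\Big).\]
   Context: A complementary alphabet with $m$ complementary pairs is a set of $2m$ letters in which every letter $B$ has a unique complement $\overline{B}\neq B$ with $\overline{\overline{B}}=B$. A plane tree is a rooted tree with linearly ordered children at each vertex. For a plane tree with $n$ edges, the $2n$ half-edges are labeled $1,\dots,2n$ by starting on the left side of the leftmost root edge and walking counterclockwise; each edge is $e(i,j)$, $i<j$, with $i,j$ the labels of its sides. For $P=p_1\cdots p_{2n}$, a plane tree with $n$ edges is $P$-valid if $p_i,p_j$ are complements for every edge $e(i,j)$. $R(n,m)$ is the set of integers $k$ such that some word $P$ of length $2n$ over a complementary alphabet with $m$ pairs has exactly $k\ge1$ $P$-valid plane trees. -}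

module Defs where

open import Data.Nat using (ℕ; zero; suc; _+_; _*_; _^_; _≤_)
open import Data.Nat.Primality using (Prime)
open import Data.Fin using (Fin)
open import Data.Bool using (Bool; not)
open import Data.List using (List; []; _∷_; _++_; length)
open import Data.List.Relation.Unary.All using (All)
open import Data.List.Relation.Unary.Unique.Propositional using (Unique)
open import Data.List.Membership.Propositional using (_∈_)
open import Data.Maybe using (Maybe; just; nothing)
open import Data.Product using (_×_; _,_; ∃; Σ-syntax)
open import Relation.Binary.PropositionalEquality using (_≡_)

-- Canonical complementary alphabet with m pairs: letters (a , b), a : Fin m,
-- b : Bool; the complement of (a , b) is (a , not b).  Every complementary alphabet with m pairs
-- is isomorphic to this one (compatibly with complementation).
Letter : ℕ → Set
Letter m = Fin m × Bool

comp : ∀ {m} → Letter m → Letter m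
comp (a , b) = (a , not b)

data Tree : Set where
  node : List Tree → Tree

mutual
  size : Tree → ℕ
  size (node cs) = sizes cs

  sizes : List Tree → ℕ
  sizes []       = 0
  sizes (c ∷ cs) = suc (size c + sizes cs)

-- Half-edge labels (0-based: label i here is label i+1 in the paper).
-- edgesF cs o lists the edges (i , j), i < j, hanging from a vertex whose
-- children are cs, when the counterclockwise contour walk reaches the
-- left side of the leftmost edge among them with next label o.
-- The edge to child (node ds) gets label o on its left side, then the walk
-- goes around that subtree (2 * sizes ds half-edges), then the right side.
edgesF : List Tree → ℕ → List (ℕ × ℕ)
edgesF []              o = []
edgesF (node ds ∷ cs) o =
  (o , o + suc (2 * sizes ds)) ∷ (edgesF ds (suc o) ++ edgesF cs (o + 2 + 2 * sizes ds))

edges : Tree → List (ℕ × ℕ)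
edges (node cs) = edgesF cs 0

at : ∀ {A : Set} → List A → ℕ → Maybe A
at []       _       = nothing
at (x ∷ xs) zero    = just x
at (x ∷ xs) (suc i) = at xs i

ComplAt : ∀ {m} → List (Letter m) → ℕ × ℕ → Set
ComplAt P (i , j) = ∃ λ a → at P i ≡ just a × at P j ≡ just (comp a)

Valid : ∀ {m} → ℕ → List (Letter m) → Tree → Set
Valid n P t = size t ≡ n × All (ComplAt P) (edges t)

NumValid : ∀ {m} → ℕ → List (Letter m) → ℕ → Set
NumValid n P k =
  Σ[ L ∈ List Tree ] (Unique L × length L ≡ k × All (Valid n P) L ×
                      (∀ t → Valid n P t → t ∈ L))

InR : ℕ → ℕ → ℕ → Set
InR n m k = 1 ≤ k × Σ[ P ∈ List (Letter m) ] (length P ≡ 2 * n × NumValid n P k)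

record Factor : Set where
  constructor factor
  field
    prime : ℕ
    expo  : ℕ
    nᵢ    : ℕ
    mᵢ    : ℕ
open Factor public

GoodFactor : Factor → Set
GoodFactor f = Prime (prime f) × 1 ≤ expo f × InR (nᵢ f) (mᵢ f) (prime f)

power : Factor → ℕ
power f = prime f ^ expo f

αn : Factor → ℕ
αn f = expo f * nᵢ f

αm : Factor → ℕ
αm f = expo f * mᵢ f

-- Write a P-word and a Q-word over disjoint halves of a larger alphabet and
-- concatenate them.  A letter of the first half is never complementary to a
-- letter of the second half, so no edge of a valid tree joins a label before
-- |P| = 2n₁ to one after it.  Hence the children of the root split into a
-- prefix of total size n₁, which must be a P-valid tree, and a suffix, which
-- must be a Q-valid tree: the valid trees are exactly the root-joins of a
-- P-valid and a Q-valid tree, so R(n₁, m₁) · R(n₂, m₂) ⊆ R(n₁ + n₂, m₁ + m₂).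
-- Together with 1 ∈ R(0, 0) this gives the theorem by induction over the
-- factorisation.
module Submission where

open import Defs
open import Data.Nat using (ℕ)
open import Data.List using (List; map)
open import Data.Nat.ListAction using (sum; product)
open import Data.List.Relation.Unary.All using (All)
open import Data.List.Relation.Unary.Unique.Propositional using (Unique)
open import Relation.Binary.PropositionalEquality using (_≡_)

open import Data.Nat
open import Data.Nat.Properties
open import Data.Nat.Tactic.RingSolver using (solve-∀)
open import Data.Fin using (_↑ˡ_; _↑ʳ_; splitAt)
open import Data.Fin.Properties using (↑ˡ-injective; ↑ʳ-injective; splitAt-↑ˡ; splitAt-↑ʳ)
open import Data.Maybe using (just)
import Data.Maybe as Maybe
import Data.Maybe.Properties as Maybe
open import Data.List using ([]; _∷_; _++_; length; cartesianProduct)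
open import Data.List.Properties using (++-assoc; map-++; map-∘; map-id-local; length-map; length-++)
open import Data.List.Relation.Unary.All as All using ([]; _∷_)
import Data.List.Relation.Unary.All.Properties as All
open import Data.List.Relation.Unary.Any using (here)
import Data.List.Relation.Unary.Unique.Propositional.Properties as Unique
import Data.List.Relation.Unary.AllPairs as AllPairs
open import Data.List.Membership.Propositional using (_∈_)
open import Data.List.Membership.Propositional.Properties
  using (∈-map⁺; ∈-cartesianProduct⁺)
open import Data.Product as Product using (∃; ∃₂; _×_; _,_; proj₁; proj₂; uncurry)
open import Data.Empty using (⊥-elim)
open import Function using (_∘_; _⇔_; mk⇔; Injective; Equivalence)
import Function.Properties.Equivalence as ⇔
open import Relation.Binary.PropositionalEquality
  using (_≢_; setoid; refl; sym; trans; cong; cong₂; subst; module ≡-Reasoning)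
open import Relation.Nullary using (¬_; yes; no)

open Equivalence using (to; from)

private
  variable
    A B : Set

sizes-++ : ∀ as bs → sizes (as ++ bs) ≡ sizes as + sizes bs
sizes-++ []       bs = refl
sizes-++ (c ∷ as) bs rewrite sizes-++ as bs = cong suc (sym (+-assoc (size c) (sizes as) (sizes bs)))

offset-after : ∀ o s r → o + 2 + 2 * s + 2 * r ≡ o + 2 * suc (s + r)
offset-after = solve-∀

edgesF-++ : ∀ as bs o → edgesF (as ++ bs) o ≡ edgesF as o ++ edgesF bs (o + 2 * sizes as)
edgesF-++ []             bs o = cong (edgesF bs) (sym (+-identityʳ o))
edgesF-++ (node ds ∷ as) bs o = cong ((o , o + suc (2 * sizes ds)) ∷_) (begin
    edgesF ds (suc o) ++ edgesF (as ++ bs) o′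
  ≡⟨ cong (edgesF ds (suc o) ++_) (edgesF-++ as bs o′) ⟩
    edgesF ds (suc o) ++ (edgesF as o′ ++ edgesF bs (o′ + 2 * sizes as))
  ≡⟨ sym (++-assoc (edgesF ds (suc o)) _ _) ⟩
    (edgesF ds (suc o) ++ edgesF as o′) ++ edgesF bs (o′ + 2 * sizes as)
  ≡⟨ cong (λ p → (edgesF ds (suc o) ++ edgesF as o′) ++ edgesF bs p)
          (offset-after o (sizes ds) (sizes as)) ⟩
    (edgesF ds (suc o) ++ edgesF as o′) ++ edgesF bs (o + 2 * sizes (node ds ∷ as))
  ∎)
  where
    open ≡-Reasoning
    o′ = o + 2 + 2 * sizes ds

shift : ℕ → ℕ × ℕ → ℕ × ℕ
shift d (i , j) = (d + i , d + j)

edgesF-shift : ∀ cs d o → edgesF cs (d + o) ≡ map (shift d) (edgesF cs o)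
edgesF-shift []             d o = refl
edgesF-shift (node ds ∷ cs) d o =
  cong₂ _∷_ (cong (d + o ,_) (+-assoc d o (suc (2 * sizes ds)))) (begin
      edgesF ds (suc (d + o)) ++ edgesF cs (d + o + 2 + 2 * sizes ds)
    ≡⟨ cong₂ (λ p q → edgesF ds p ++ edgesF cs q) (sym (+-suc d o)) (reassoc d o (sizes ds)) ⟩
      edgesF ds (d + suc o) ++ edgesF cs (d + (o + 2 + 2 * sizes ds))
    ≡⟨ cong₂ _++_ (edgesF-shift ds d (suc o)) (edgesF-shift cs d (o + 2 + 2 * sizes ds)) ⟩
      map (shift d) (edgesF ds (suc o)) ++ map (shift d) (edgesF cs (o + 2 + 2 * sizes ds))
    ≡⟨ sym (map-++ (shift d) (edgesF ds (suc o)) _) ⟩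
      map (shift d) (edgesF ds (suc o) ++ edgesF cs (o + 2 + 2 * sizes ds))
    ∎)
  where
    open ≡-Reasoning
    reassoc : ∀ d o s → d + o + 2 + 2 * s ≡ d + (o + 2 + 2 * s)
    reassoc = solve-∀

Below : ℕ → ℕ × ℕ → Set
Below L (i , j) = i < L × j < L

Below-mono : ∀ {L L′} → L ≤ L′ → ∀ e → Below L e → Below L′ e
Below-mono L≤L′ (i , j) (i<L , j<L) = <-≤-trans i<L L≤L′ , <-≤-trans j<L L≤L′

edgesF-below : ∀ cs o → All (Below (o + 2 * sizes cs)) (edgesF cs o)
edgesF-below []             o = []
edgesF-below (node ds ∷ cs) o =
  (m<m+n o z<s , +-monoʳ-< o (last-label (sizes ds) (sizes cs)))
  ∷ All.++⁺ (All.map (λ {e} → Below-mono (first-block o (sizes ds) (sizes cs)) e)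
                     (edgesF-below ds (suc o)))
            (All.map (λ {e} → subst (λ L → Below L e) (offset-after o (sizes ds) (sizes cs)))
                     (edgesF-below cs (o + 2 + 2 * sizes ds)))
  where
    last-label : ∀ s r → suc (2 * s) < 2 * suc (s + r)
    last-label s r = subst (suc (suc (2 * s)) ≤_) (sym (eq s r)) (s≤s (s≤s (m≤m+n (2 * s) (2 * r))))
      where
        eq : ∀ s r → 2 * suc (s + r) ≡ suc (suc (2 * s + 2 * r))
        eq = solve-∀
    first-block : ∀ o s r → suc o + 2 * s ≤ o + 2 * suc (s + r)
    first-block o s r = subst (_≤ o + 2 * suc (s + r)) (sym (eq o s)) (+-monoʳ-≤ o (<⇒≤ (last-label s r)))
      where
        eq : ∀ o s → suc o + 2 * s ≡ o + suc (2 * s)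
        eq = solve-∀

edges-below : ∀ t → All (Below (2 * size t)) (edges t)
edges-below (node cs) = edgesF-below cs 0

Crosses : ℕ → ℕ × ℕ → Set
Crosses L (i , j) = i < L × L ≤ j

split-noncrossing : ∀ cs o r → r ≤ sizes cs → All (¬_ ∘ Crosses (o + 2 * r)) (edgesF cs o) →
                    ∃₂ λ as bs → cs ≡ as ++ bs × sizes as ≡ r
split-noncrossing cs             o zero    _  _                = [] , cs , refl , refl
split-noncrossing (node ds ∷ cs) o (suc r) r≤ (¬crosses ∷ rest) with sizes ds ≤? r
... | no s≰r = ⊥-elim (¬crosses (m<m+n o z<s , +-monoʳ-≤ o 2r+2≤2s+1))
  where
    2r+2≤2s+1 : 2 * suc r ≤ suc (2 * sizes ds)
    2r+2≤2s+1 = m≤n⇒m≤1+n (*-monoʳ-≤ 2 (≰⇒> s≰r))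
... | yes s≤r with d , refl ← m≤n⇒∃[o]m+o≡n s≤r
                  with as , bs , refl , sizes-as ← split-noncrossing cs (o + 2 + 2 * sizes ds) d
                         (+-cancelˡ-≤ (sizes ds) d (sizes cs) (s≤s⁻¹ r≤))
                         (subst (λ L → All (¬_ ∘ Crosses L) (edgesF cs (o + 2 + 2 * sizes ds)))
                                (sym (offset-after o (sizes ds) d)) (All.++⁻ʳ (edgesF ds (suc o)) rest))
  = node ds ∷ as , bs , refl , cong (suc ∘ (sizes ds +_)) sizes-as

joinRoots : Tree → Tree → Tree
joinRoots (node as) (node bs) = node (as ++ bs)

size-joinRoots : ∀ t₁ t₂ → size (joinRoots t₁ t₂) ≡ size t₁ + size t₂
size-joinRoots (node as) (node bs) = sizes-++ as bs

edges-joinRoots : ∀ t₁ t₂ → edges (joinRoots t₁ t₂) ≡ edges t₁ ++ map (shift (2 * size t₁)) (edges t₂)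
edges-joinRoots (node as) (node bs) =
  trans (edgesF-++ as bs 0)
        (cong (edgesF as 0 ++_) (trans (cong (edgesF bs) (sym (+-identityʳ _))) (edgesF-shift bs _ 0)))

splitChildren : ℕ → List Tree → List Tree × List Tree
splitChildren zero    cs       = [] , cs
splitChildren (suc r) []       = [] , []
splitChildren (suc r) (c ∷ cs) = Product.map₁ (c ∷_) (splitChildren (r ∸ size c) cs)

splitChildren-++ : ∀ as bs → splitChildren (sizes as) (as ++ bs) ≡ (as , bs)
splitChildren-++ []       bs = refl
splitChildren-++ (c ∷ as) bs rewrite m+n∸m≡n (size c) (sizes as) | splitChildren-++ as bs = refl

splitRoot : ℕ → Tree → Tree × Tree
splitRoot r (node cs) = Product.map node node (splitChildren r cs)

splitRoot-joinRoots : ∀ t₁ t₂ → splitRoot (size t₁) (joinRoots t₁ t₂) ≡ (t₁ , t₂)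
splitRoot-joinRoots (node as) (node bs) rewrite splitChildren-++ as bs = refl

at-++ˡ : ∀ (xs ys : List A) {i} → i < length xs → at (xs ++ ys) i ≡ at xs i
at-++ˡ (x ∷ xs) ys {zero}  _          = refl
at-++ˡ (x ∷ xs) ys {suc i} (s≤s i<xs) = at-++ˡ xs ys i<xs

at-++ʳ : ∀ (xs ys : List A) {l} → length xs ≡ l → ∀ i → at (xs ++ ys) (l + i) ≡ at ys i
at-++ʳ []       ys refl i = refl
at-++ʳ (x ∷ xs) ys refl i = at-++ʳ xs ys refl i

at-map : ∀ (f : A → B) xs i → at (map f xs) i ≡ Maybe.map f (at xs i)
at-map f []       i       = refl
at-map f (x ∷ xs) zero    = refl
at-map f (x ∷ xs) (suc i) = at-map f xs i

at-map⁻ : ∀ (f : A → B) xs i {y} → at (map f xs) i ≡ just y → ∃ λ x → at xs i ≡ just x × f x ≡ y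
at-map⁻ f (x ∷ xs) zero    refl = x , refl , refl
at-map⁻ f (x ∷ xs) (suc i) eq   = at-map⁻ f xs i eq

module _ {m : ℕ} where

  ComplAt-cong : ∀ (P P′ : List (Letter m)) i j i′ j′ →
                 at P i ≡ at P′ i′ → at P j ≡ at P′ j′ → ComplAt P (i , j) ⇔ ComplAt P′ (i′ , j′)
  ComplAt-cong _ _ _ _ _ _ eqᵢ eqⱼ =
    mk⇔ (λ (a , p , q) → a , trans (sym eqᵢ) p , trans (sym eqⱼ) q)
        (λ (a , p , q) → a , trans eqᵢ p , trans eqⱼ q)

  ComplAt-++ˡ : ∀ (P Q : List (Letter m)) e → Below (length P) e → ComplAt (P ++ Q) e ⇔ ComplAt P e
  ComplAt-++ˡ P Q (i , j) (i<P , j<P) = ComplAt-cong (P ++ Q) P i j i j (at-++ˡ P Q i<P) (at-++ˡ P Q j<P)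

  ComplAt-++ʳ : ∀ (P Q : List (Letter m)) {d} → length P ≡ d →
                ∀ e → ComplAt (P ++ Q) (shift d e) ⇔ ComplAt Q e
  ComplAt-++ʳ P Q {d} |P| (i , j) =
    ComplAt-cong (P ++ Q) Q (d + i) (d + j) i j (at-++ʳ P Q |P| i) (at-++ʳ P Q |P| j)

  ComplAt-map : ∀ {m′} {f : Letter m → Letter m′} → Injective _≡_ _≡_ f → (∀ x → f (comp x) ≡ comp (f x)) →
                ∀ P e → ComplAt (map f P) e ⇔ ComplAt P e
  ComplAt-map {f = f} f-injective f-comp P (i , j) = mk⇔ lower lift
    where
      lower : ComplAt (map f P) (i , j) → ComplAt P (i , j)
      lower (x , p , q) with a , pa , refl ← at-map⁻ f P i p =
        a , pa , Maybe.map-injective f-injective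
                   (trans (sym (at-map f P j)) (trans q (cong just (sym (f-comp a)))))
      lift : ComplAt P (i , j) → ComplAt (map f P) (i , j)
      lift (a , p , q) =
        f a , trans (at-map f P i) (Maybe.map-just p)
            , trans (at-map f P j) (trans (Maybe.map-just q) (cong just (f-comp a)))

module Juxtaposition (m₁ m₂ : ℕ) where

  inl : Letter m₁ → Letter (m₁ + m₂)
  inl (a , b) = a ↑ˡ m₂ , b

  inr : Letter m₂ → Letter (m₁ + m₂)
  inr (a , b) = m₁ ↑ʳ a , b

  inl-injective : Injective _≡_ _≡_ inl
  inl-injective {a , _} {a′ , _} eq = cong₂ _,_ (↑ˡ-injective m₂ a a′ (cong proj₁ eq)) (cong proj₂ eq)

  inr-injective : Injective _≡_ _≡_ inr
  inr-injective {a , _} {a′ , _} eq = cong₂ _,_ (↑ʳ-injective m₁ a a′ (cong proj₁ eq)) (cong proj₂ eq)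

  inl≢inr : ∀ x y → inl x ≢ inr y
  inl≢inr (a , _) (b , _) eq
    with () ← trans (sym (splitAt-↑ˡ m₁ a m₂)) (trans (cong (splitAt m₁ ∘ proj₁) eq) (splitAt-↑ʳ m₁ m₂ b))

  _⊗_ : List (Letter m₁) → List (Letter m₂) → List (Letter (m₁ + m₂))
  P ⊗ Q = map inl P ++ map inr Q

  length-⊗ : ∀ P Q → length (P ⊗ Q) ≡ length P + length Q
  length-⊗ P Q = trans (length-++ (map inl P)) (cong₂ _+_ (length-map inl P) (length-map inr Q))

  ComplAt-⊗ˡ : ∀ P Q e → Below (length P) e → ComplAt (P ⊗ Q) e ⇔ ComplAt P e
  ComplAt-⊗ˡ P Q e below =
    ⇔.trans (ComplAt-++ˡ (map inl P) (map inr Q) e (subst (λ L → Below L e) (sym (length-map inl P)) below))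
            (ComplAt-map inl-injective (λ _ → refl) P e)

  ComplAt-⊗ʳ : ∀ P Q {d} → length P ≡ d → ∀ e → ComplAt (P ⊗ Q) (shift d e) ⇔ ComplAt Q e
  ComplAt-⊗ʳ P Q |P| e =
    ⇔.trans (ComplAt-++ʳ (map inl P) (map inr Q) (trans (length-map inl P) |P|) e)
            (ComplAt-map inr-injective (λ _ → refl) Q e)

  ComplAt-⊗-noncrossing : ∀ P Q e → ComplAt (P ⊗ Q) e → ¬ Crosses (length P) e
  ComplAt-⊗-noncrossing P Q (i , j) (_ , p , q) (i<P , P≤j)
    with d , refl ← m≤n⇒∃[o]m+o≡n P≤j
    with a , _ , refl ← at-map⁻ inl P i
           (trans (sym (at-++ˡ (map inl P) (map inr Q) (subst (i <_) (sym (length-map inl P)) i<P))) p)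
    with b , _ , inr-b≡comp-inl-a ← at-map⁻ inr Q d
           (trans (sym (at-++ʳ (map inl P) (map inr Q) (length-map inl P) d)) q)
    = inl≢inr (comp a) b (sym inr-b≡comp-inl-a)

  module _ {n₁ n₂ : ℕ} (P : List (Letter m₁)) (Q : List (Letter m₂)) (|P| : length P ≡ 2 * n₁) where

    valid-joinRoots : ∀ t₁ t₂ → size t₁ ≡ n₁ →
                      Valid (n₁ + n₂) (P ⊗ Q) (joinRoots t₁ t₂) ⇔ (Valid n₁ P t₁ × Valid n₂ Q t₂)
    valid-joinRoots t₁ t₂ refl = mk⇔ split join
      where
        below : All (Below (length P)) (edges t₁)
        below = subst (λ L → All (Below L) (edges t₁)) (sym |P|) (edges-below t₁)
        split : Valid (size t₁ + n₂) (P ⊗ Q) (joinRoots t₁ t₂) → Valid (size t₁) P t₁ × Valid n₂ Q t₂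
        split (size≡ , valid) =
          (refl , All.zipWith (λ {e} (b , c) → to (ComplAt-⊗ˡ P Q e b) c)
                              (below , All.++⁻ˡ (edges t₁) valid′))
          , (+-cancelˡ-≡ (size t₁) _ _ (trans (sym (size-joinRoots t₁ t₂)) size≡)
          , All.map (λ {e} → to (ComplAt-⊗ʳ P Q |P| e)) (All.map⁻ (All.++⁻ʳ (edges t₁) valid′)))
          where valid′ = subst (All (ComplAt (P ⊗ Q))) (edges-joinRoots t₁ t₂) valid
        join : Valid (size t₁) P t₁ × Valid n₂ Q t₂ → Valid (size t₁ + n₂) (P ⊗ Q) (joinRoots t₁ t₂)
        join ((_ , valid₁) , (size₂ , valid₂)) =
          trans (size-joinRoots t₁ t₂) (cong (size t₁ +_) size₂)
          , subst (All (ComplAt (P ⊗ Q))) (sym (edges-joinRoots t₁ t₂))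
              (All.++⁺ (All.zipWith (λ {e} (b , c) → from (ComplAt-⊗ˡ P Q e b) c) (below , valid₁))
                       (All.map⁺ (All.map (λ {e} → from (ComplAt-⊗ʳ P Q |P| e)) valid₂)))

    valid-split : ∀ t → Valid (n₁ + n₂) (P ⊗ Q) t → ∃₂ λ t₁ t₂ → t ≡ joinRoots t₁ t₂ × size t₁ ≡ n₁
    valid-split (node cs) (size≡ , valid)
      with as , bs , refl , sizes-as ← split-noncrossing cs 0 n₁
             (subst (n₁ ≤_) (sym size≡) (m≤m+n n₁ n₂))
             (subst (λ L → All (¬_ ∘ Crosses L) (edgesF cs 0)) |P|
                    (All.map (λ {e} → ComplAt-⊗-noncrossing P Q e) valid))
      = node as , node bs , refl , sizes-as

length-cartesianProduct : ∀ (xs : List A) (ys : List B) →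
                          length (cartesianProduct xs ys) ≡ length xs * length ys
length-cartesianProduct []       ys = refl
length-cartesianProduct (x ∷ xs) ys =
  trans (length-++ (map (x ,_) ys)) (cong₂ _+_ (length-map (x ,_) ys) (length-cartesianProduct xs ys))

joinAll : List Tree → List Tree → List Tree
joinAll L₁ L₂ = map (uncurry joinRoots) (cartesianProduct L₁ L₂)

-- joinRoots is not injective, but splitRoot n undoes it when the left tree has n edges.
joinAll-unique : ∀ {n L₁ L₂} → All (λ t → size t ≡ n) L₁ → Unique L₁ → Unique L₂ → Unique (joinAll L₁ L₂)
joinAll-unique {n} {L₁} {L₂} sized u₁ u₂ =
  Unique.map⁻ (subst Unique (sym splitRoot∘joinRoots≡id) (Unique.cartesianProduct⁺ u₁ u₂))
  where
    splitRoot∘joinRoots≡id : map (splitRoot n) (joinAll L₁ L₂) ≡ cartesianProduct L₁ L₂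
    splitRoot∘joinRoots≡id =
      trans (sym (map-∘ (cartesianProduct L₁ L₂)))
            (map-id-local (All.cartesianProduct⁺ (setoid Tree) (setoid Tree) L₁ L₂ λ {t₁} {t₂} t₁∈L₁ _ →
               subst (λ r → splitRoot r (joinRoots t₁ t₂) ≡ (t₁ , t₂)) (All.lookup sized t₁∈L₁)
                     (splitRoot-joinRoots t₁ t₂)))

module _ {m₁ m₂ : ℕ} where
  open Juxtaposition m₁ m₂

  NumValid-⊗ : ∀ {n₁ n₂ k₁ k₂} (P : List (Letter m₁)) (Q : List (Letter m₂)) → length P ≡ 2 * n₁ →
               NumValid n₁ P k₁ → NumValid n₂ Q k₂ → NumValid (n₁ + n₂) (P ⊗ Q) (k₁ * k₂)
  NumValid-⊗ {n₁} {n₂} P Q |P| (L₁ , u₁ , refl , valid₁ , complete₁)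
                               (L₂ , u₂ , refl , valid₂ , complete₂) =
    joinAll L₁ L₂ ,
    joinAll-unique (All.map proj₁ valid₁) u₁ u₂ ,
    trans (length-map _ (cartesianProduct L₁ L₂)) (length-cartesianProduct L₁ L₂) ,
    All.map⁺ (All.cartesianProduct⁺ (setoid Tree) (setoid Tree) L₁ L₂ λ {t₁} {t₂} t₁∈L₁ t₂∈L₂ →
      let v₁ = All.lookup valid₁ t₁∈L₁
      in  from (valid-joinRoots P Q |P| t₁ t₂ (proj₁ v₁)) (v₁ , All.lookup valid₂ t₂∈L₂)) ,
    complete
    where
      complete : ∀ t → Valid (n₁ + n₂) (P ⊗ Q) t → t ∈ joinAll L₁ L₂
      complete t valid with t₁ , t₂ , refl , size₁ ← valid-split P Q |P| t valid
        with v₁ , v₂ ← to (valid-joinRoots P Q |P| t₁ t₂ size₁) valid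
        = ∈-map⁺ (uncurry joinRoots) (∈-cartesianProduct⁺ (complete₁ t₁ v₁) (complete₂ t₂ v₂))

InR-* : ∀ {n₁ n₂ m₁ m₂ k₁ k₂} → InR n₁ m₁ k₁ → InR n₂ m₂ k₂ → InR (n₁ + n₂) (m₁ + m₂) (k₁ * k₂)
InR-* {n₁} {n₂} {m₁} {m₂} (1≤k₁ , P , |P| , N₁) (1≤k₂ , Q , |Q| , N₂) =
  *-mono-≤ 1≤k₁ 1≤k₂ ,
  P ⊗ Q ,
  trans (length-⊗ P Q) (trans (cong₂ _+_ |P| |Q|) (sym (*-distribˡ-+ 2 n₁ n₂))) ,
  NumValid-⊗ P Q |P| N₁ N₂
  where open Juxtaposition m₁ m₂

InR-one : InR 0 0 1
InR-one =
  s≤s z≤n , [] , refl , node [] ∷ [] , [] AllPairs.∷ AllPairs.[] , refl , (refl , []) ∷ [] , only-root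
  where
    only-root : ∀ t → Valid 0 [] t → t ∈ node [] ∷ []
    only-root (node [])      _        = here refl
    only-root (node (_ ∷ _)) (() , _)

InR-^ : ∀ {n m p} → InR n m p → ∀ a → InR (a * n) (a * m) (p ^ a)
InR-^ inR zero    = InR-one
InR-^ inR (suc a) = InR-* inR (InR-^ inR a)

InR-product : ∀ fs → All GoodFactor fs → InR (sum (map αn fs)) (sum (map αm fs)) (product (map power fs))
InR-product []       []                   = InR-one
InR-product (f ∷ fs) ((_ , _ , inR) ∷ gs) = InR-* (InR-^ inR (expo f)) (InR-product fs gs)

mainTheorem13 : (k : ℕ) (fs : List Factor) →
    All GoodFactor fs →
    Unique (map prime fs) →
    k ≡ product (map power fs) →
    InR (sum (map αn fs)) (sum (map αm fs)) k
mainTheorem13 k fs good _ refl = InR-product fs good
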